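{- For all positive integers $n$ and $k$, there exist a tree space $\mathcal{T}$ with at most $k$ leaves and a set $\mathcal{A}$ of at most $n$ paths in $\mathcal{T}$ such that every conflict-free coloring of $\mathcal{A}$ uses at least $\lfloor \log_2\min(k,n)\rfloor$ colors. In other words, $\chi^{\mathrm{CF}}_{\mathrm{tree}}(\mathrm{paths};k;n)\ge \lfloor\log_2\min(k,n)\rfloor$.
   Context: A network space is a 1-dimensional space with the topology of a graph (nodes are points, edges are simple curves joining pairs of nodes, otherwise disjoint); a tree space is a network space whose underlying graph is a tree. A path in a tree space is a connected subset homeomorphic to a (possibly degenerate) segment, i.e., a connected subset with at most two leaves. For a set $\mathcal{A}$ of objects and a point $p$, $S_p=\{o\in\mathcal{A}:p\in o\}$. A coloring of $\mathcal{A}$ is conflict-free if for every point $p$ with $S_p\ne\emptyset$, some object of $S_p$ has a color different from the colors of all other objects in $S_p$. $\chi^{\mathrm{CF}}_{\mathrm{tree}}(\mathrm{paths};k;n)$ is the minimum number of colors sufficient to CF-color any set of $n$ paths in any tree space with at most $k$ leaves. -}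

module Defs where

open import Data.Nat using (ℕ; zero; suc; _+_; _≤_; _≤ᵇ_)
open import Data.Fin using (Fin; zero; suc; toℕ; _≟_)
open import Data.Fin.Properties using () renaming (_≟_ to _≟F_)
open import Data.Bool using (Bool; true; false; if_then_else_; _∨_)
open import Data.List using (List; []; _∷_; map; allFin)
open import Data.Nat.ListAction using (sum)
open import Data.List.Membership.Propositional using (_∈_)
open import Data.List.Relation.Unary.Linked using (Linked)
open import Data.List.Relation.Unary.Unique.Propositional using (Unique)
open import Data.Product using (Σ; ∃; _×_; _,_)
open import Data.Sum using (_⊎_)
open import Relation.Nullary using (¬_; does)
open import Relation.Binary.PropositionalEquality using (_≡_; _≢_)

-- A finite tree, presented canonically: vertices are Fin (suc m); vertex 0 is
-- the root, and each vertex (suc i) has a parent (par i) of smaller index.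
-- Every finite tree admits such a presentation (number vertices in BFS order).
record Tree : Set where
  field
    m      : ℕ
    par    : Fin m → Fin (suc m)
    par-lt : ∀ i → toℕ (par i) ≤ toℕ i

  Vertex : Set
  Vertex = Fin (suc m)

  Adj : Vertex → Vertex → Set
  Adj u w = (∃ λ i → u ≡ suc i × par i ≡ w) ⊎ (∃ λ j → w ≡ suc j × par j ≡ u)

  parentOf : Vertex → Vertex → Bool
  parentOf zero    w = false
  parentOf (suc i) w = does (par i ≟F w)

  adjᵇ : Vertex → Vertex → Bool
  adjᵇ u w = parentOf u w ∨ parentOf w u

  degree : Vertex → ℕ
  degree u = sum (map (λ w → if adjᵇ u w then 1 else 0) (allFin (suc m)))

  numLeaves : ℕ
  numLeaves = sum (map (λ u → if degree u ≤ᵇ 1 then 1 else 0) (allFin (suc m)))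

  record Path : Set where
    field
      verts    : List Vertex
      nonempty : verts ≢ []
      walk     : Linked Adj verts
      simple   : Unique verts

  _∈P_ : Vertex → Path → Set
  x ∈P P = x ∈ Path.verts P

  ConflictFree : ∀ {N r} → (Fin N → Path) → (Fin N → Fin r) → Set
  ConflictFree {N} A c =
    ∀ (p : Vertex) → (∃ λ i → p ∈P A i) →
      ∃ λ i → p ∈P A i × (∀ j → p ∈P A j → j ≢ i → c j ≢ c i)

  DistinctPaths : ∀ {N} → (Fin N → Path) → Set
  DistinctPaths {N} A =
    ∀ i j → i ≢ j → ¬ (∀ x → (x ∈P A i → x ∈P A j) × (x ∈P A j → x ∈P A i))

-- Let d + 1 = ⌊log₂ min(k, n)⌋ and take the 2^d ≤ n root-to-leaf paths of the complete binary
-- tree of depth d, which has at most 2^(d+1) ≤ k vertices and hence at most k leaves. At any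
-- vertex x, some path through x has a colour seen on no other path through x; that path leaves
-- x towards one child, and every path through the other child also passes x, so it avoids that
-- colour. Descending from the root in this way collects d + 1 paths of pairwise distinct colours.
module Submission where

open import Defs
open import Data.Nat using (ℕ; _≤_; _⊓_; NonZero)
open import Data.Nat.Logarithm using (⌊log₂_⌋)
open import Data.Fin using (Fin)
open import Data.Product using (Σ; ∃; _×_)

open import Data.Bool using (Bool; true; false; not; if_then_else_)
open import Data.Bool.Properties using (not-¬)
open import Data.Empty using (⊥-elim)
open import Data.Fin using (zero; suc; toℕ; fromℕ<; combine; remQuot)
open import Data.Fin.Properties using (toℕ-fromℕ<; toℕ-injective; toℕ<n; remQuot-combine; combine-remQuot; injective⇒≤; 2↔Bool)
open import Data.List using (List; []; _∷_; map; allFin; length; tails; _++_; replicate)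
open import Data.List.Properties using (∷-injectiveˡ; ∷-injectiveʳ; length-++; length-replicate; length-tabulate)
open import Data.List.Membership.Propositional using (_∈_)
open import Data.List.Membership.Propositional.Properties using (∈-map⁺; ∈-map⁻)
open import Data.List.Relation.Unary.Any using (here; there)
open import Data.List.Relation.Unary.All as All using ()
open import Data.List.Relation.Unary.AllPairs using ([]; _∷_)
open import Data.List.Relation.Unary.Linked using (Linked; [-]; _∷_)
open import Data.List.Relation.Unary.Unique.Propositional using (Unique)
open import Data.Nat using (zero; suc; _+_; _*_; _^_; _<_; _∸_; pred; z≤n; s≤s; ⌊_/2⌋; ⌈_/2⌉; _≤ᵇ_; >-nonZero; >-nonZero⁻¹)
open import Data.Nat.DivMod using (_mod_; m<n⇒m%n≡m)
open import Data.Nat.Induction using (<-wellFounded)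
open import Data.Nat.ListAction using (sum)
open import Data.Nat.Logarithm using (⌊log₂⌊n/2⌋⌋≡⌊log₂n⌋∸1; ⌊log₂[2^n]⌋≡n)
open import Data.Nat.Properties
open import Data.Product using (_,_; proj₁; proj₂; uncurry)
open import Data.Sum using (inj₁)
open import Function using (_∘_)
open import Function.Bundles using (Inverse)
open import Function.Definitions using (Injective)
open import Induction.WellFounded using (Acc; acc)
open import Relation.Binary.PropositionalEquality using (_≡_; _≢_; refl; sym; trans; cong; cong₂; subst; module ≡-Reasoning)

private variable
  A : Set
  a : A
  x y z : List A

∈-tails-length : ∀ (x : List A) → y ∈ tails x → length y ≤ length x
∈-tails-length x       (here refl) = ≤-refl
∈-tails-length (_ ∷ x) (there p)   = m≤n⇒m≤1+n (∈-tails-length x p)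

∈-tails-tail : ∀ (x : List A) → (a ∷ y) ∈ tails x → y ∈ tails x
∈-tails-tail (_ ∷ x) (here refl) = there (here refl)
∈-tails-tail (_ ∷ x) (there p)   = there (∈-tails-tail x p)

∈-tails-++ : ∀ (ys x : List A) → x ∈ tails (ys ++ x)
∈-tails-++ []       x = here refl
∈-tails-++ (_ ∷ ys) x = there (∈-tails-++ ys x)

∈-tails-≡ : ∀ (x : List A) → y ∈ tails x → z ∈ tails x → length y ≡ length z → y ≡ z
∈-tails-≡ x       (here refl) (here refl) _ = refl
∈-tails-≡ (_ ∷ x) (here refl) (there q)   e = ⊥-elim (<-irrefl (sym e) (s≤s (∈-tails-length x q)))
∈-tails-≡ (_ ∷ x) (there p)   (here refl) e = ⊥-elim (<-irrefl e (s≤s (∈-tails-length x p)))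
∈-tails-≡ (_ ∷ x) (there p)   (there q)   e = ∈-tails-≡ x p q e

∈-tails-extend : ∀ (x : List A) → y ∈ tails x → length y < length x → ∃ λ a → (a ∷ y) ∈ tails x
∈-tails-extend x           (here refl)         lt = ⊥-elim (<-irrefl refl lt)
∈-tails-extend (a ∷ x)     (there (here refl)) _  = a , here refl
∈-tails-extend (a ∷ b ∷ x) (there (there p))   _  =
  let c , q = ∈-tails-extend (b ∷ x) (there p) (s≤s (∈-tails-length x p)) in c , there q

open Inverse 2↔Bool using () renaming (to to bit; from to digit; strictlyInverseˡ to bit-digit; strictlyInverseʳ to digit-bit)

word : ∀ d → Fin (2 ^ d) → List Bool
word zero    _ = []
word (suc d) j = uncurry (λ i j′ → bit i ∷ word d j′) (remQuot (2 ^ d) j)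

word-length : ∀ d j → length (word d j) ≡ d
word-length zero    _ = refl
word-length (suc d) j = cong suc (word-length d (proj₂ (remQuot (2 ^ d) j)))

word-injective : ∀ d → Injective _≡_ _≡_ (word d)
word-injective zero    {zero} {zero} _ = refl
word-injective (suc d) {j} {j′} eq = begin
  j                                    ≡⟨ combine-remQuot (2 ^ d) j ⟨
  uncurry combine (remQuot (2 ^ d) j)  ≡⟨ cong (uncurry combine) (cong₂ _,_ digits rests) ⟩
  uncurry combine (remQuot (2 ^ d) j′) ≡⟨ combine-remQuot (2 ^ d) j′ ⟩
  j′                                   ∎
  where
  open ≡-Reasoning
  digits : proj₁ (remQuot (2 ^ d) j) ≡ proj₁ (remQuot (2 ^ d) j′)
  digits = trans (sym (digit-bit _)) (trans (cong digit (∷-injectiveˡ eq)) (digit-bit _))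
  rests : proj₂ (remQuot (2 ^ d) j) ≡ proj₂ (remQuot (2 ^ d) j′)
  rests = word-injective d (∷-injectiveʳ eq)

word-surjective : ∀ d (x : List Bool) → length x ≡ d → ∃ λ j → word d j ≡ x
word-surjective zero    []      _  = zero , refl
word-surjective (suc d) (b ∷ x) eq with word-surjective d x (suc-injective eq)
... | j , refl = combine (digit b) j ,
  trans (cong (uncurry (λ i j′ → bit i ∷ word d j′)) (remQuot-combine (digit b) j)) (cong (_∷ word d j) (bit-digit b))

∈-tails-word : ∀ d (x : List Bool) → length x ≤ d → ∃ λ j → x ∈ tails (word d j)
∈-tails-word d x le =
  let j , eq = word-surjective d (padding ++ x) padded-length
  in  j , subst (λ w → x ∈ tails w) (sym eq) (∈-tails-++ padding x)
  where
  padding : List Bool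
  padding = replicate (d ∸ length x) false
  padded-length : length (padding ++ x) ≡ d
  padded-length = trans (length-++ padding) (trans (cong (_+ length x) (length-replicate _)) (m∸n+n≡m le))

module SuffixColouring {N r : ℕ} (w : Fin N → List Bool) (c : Fin N → Fin r) where

  UniqueColourAt : List Bool → Set
  UniqueColourAt x = ∃ λ i → x ∈ tails (w i) × (∀ j → x ∈ tails (w j) → j ≢ i → c j ≢ c i)

  module _ {d : ℕ} (w-length : ∀ j → length (w j) ≡ d)
           (unique : ∀ x → length x ≤ d → UniqueColourAt x) where

    distinctColoursThrough : ∀ h {x} → h + length x ≡ d →
      Σ (Fin (suc h) → Fin N) λ g → (∀ a → x ∈ tails (w (g a))) × Injective _≡_ _≡_ (c ∘ g)
    distinctColoursThrough zero {x} eq =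
      let i , x∈wi , _ = unique x (≤-reflexive eq)
      in  (λ _ → i) , (λ _ → x∈wi) , λ { {zero} {zero} _ → refl }
    distinctColoursThrough (suc h) {x} eq
      with unique x (subst (length x ≤_) eq (m≤n+m _ (suc h)))
    ... | i , x∈wi , uniq
      with ∈-tails-extend (w i) x∈wi (subst (length x <_) (trans eq (sym (w-length i))) (s≤s (m≤n+m _ h)))
    ... | b , bx∈wi
      with distinctColoursThrough h {not b ∷ x} (trans (+-suc h _) eq)
    ... | g , through , injective = g⁺ , through⁺ , injective⁺
      where
      g⁺ : Fin (suc (suc h)) → Fin N
      g⁺ zero    = i
      g⁺ (suc a) = g a

      through⁺ : ∀ a → x ∈ tails (w (g⁺ a))
      through⁺ zero    = x∈wi
      through⁺ (suc a) = ∈-tails-tail (w (g a)) (through a)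

      -- path i leaves x towards b ∷ x, the paths g a towards not b ∷ x
      g≢i : ∀ a → g a ≢ i
      g≢i a g≡i = not-¬ refl (sym (∷-injectiveˡ (∈-tails-≡ (w i) not-bx∈wi bx∈wi refl)))
        where
        not-bx∈wi : (not b ∷ x) ∈ tails (w i)
        not-bx∈wi = subst (λ j → (not b ∷ x) ∈ tails (w j)) g≡i (through a)

      colour≢ : ∀ a → c (g a) ≢ c i
      colour≢ a = uniq (g a) (through⁺ (suc a)) (g≢i a)

      injective⁺ : Injective _≡_ _≡_ (c ∘ g⁺)
      injective⁺ {zero}  {zero}   _  = refl
      injective⁺ {zero}  {suc a′} eq = ⊥-elim (colour≢ a′ (sym eq))
      injective⁺ {suc a} {zero}   eq = ⊥-elim (colour≢ a eq)
      injective⁺ {suc a} {suc a′} eq = cong suc (injective eq)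

    colours≥ : suc d ≤ r
    colours≥ = let _ , _ , injective = distinctColoursThrough d {[]} (+-identityʳ d) in injective⇒≤ injective

push : Bool → ℕ → ℕ
push false v = v + v
push true  v = suc (v + v)

⌊push/2⌋ : ∀ b v → ⌊ push b v /2⌋ ≡ v
⌊push/2⌋ false v = sym (n≡⌊n+n/2⌋ v)
⌊push/2⌋ true  v = sym (n≡⌈n+n/2⌉ v)

push-injectiveʳ : ∀ {b c v w} → push b v ≡ push c w → v ≡ w
push-injectiveʳ {b} {c} {v} {w} eq = begin
  v              ≡⟨ ⌊push/2⌋ b v ⟨
  ⌊ push b v /2⌋ ≡⟨ cong ⌊_/2⌋ eq ⟩
  ⌊ push c w /2⌋ ≡⟨ ⌊push/2⌋ c w ⟩
  w              ∎
  where open ≡-Reasoning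

push-injectiveˡ : ∀ {b c v} → push b v ≡ push c v → b ≡ c
push-injectiveˡ {false} {false} _  = refl
push-injectiveˡ {false} {true}  eq = ⊥-elim (1+n≢n (sym eq))
push-injectiveˡ {true}  {false} eq = ⊥-elim (1+n≢n eq)
push-injectiveˡ {true}  {true}  _  = refl

push≤ : ∀ b v → push b v ≤ suc (v + v)
push≤ false v = n≤1+n _
push≤ true  v = ≤-refl

-- A word names the vertex reached from the root by its letters read from the end, so the
-- suffixes of a word are its ancestors; in heap numbering the children of v are 2v + 1 and 2v + 2.
heapIndex : List Bool → ℕ
heapIndex []      = 0
heapIndex (b ∷ x) = suc (push b (heapIndex x))

heapIndex-injective : Injective _≡_ _≡_ heapIndex
heapIndex-injective {[]}    {[]}    _  = refl
heapIndex-injective {b ∷ x} {c ∷ y} eq with heapIndex-injective {x} {y} (push-injectiveʳ {b} {c} (suc-injective eq))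
... | refl = cong (_∷ x) (push-injectiveˡ (suc-injective eq))

heapIndex-bound : ∀ x → 2 + heapIndex x ≤ 2 ^ suc (length x)
heapIndex-bound []      = ≤-refl
heapIndex-bound (b ∷ x) = begin
  3 + push b v                       ≤⟨ +-monoʳ-≤ 3 (push≤ b v) ⟩
  4 + (v + v)                        ≡⟨ cong (2 +_) (trans (+-suc v (suc v)) (cong suc (+-suc v v))) ⟨
  (2 + v) + (2 + v)                  ≤⟨ +-mono-≤ (heapIndex-bound x) (heapIndex-bound x) ⟩
  2 ^ suc (length x) + 2 ^ suc (length x) ≡⟨ cong (2 ^ suc (length x) +_) (+-identityʳ _) ⟨
  2 ^ suc (suc (length x))           ∎
  where
  open ≤-Reasoning
  v = heapIndex x

count≤length : ∀ (p : A → Bool) xs → sum (map (λ a → if p a then 1 else 0) xs) ≤ length xs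
count≤length p []       = z≤n
count≤length p (a ∷ xs) with p a
... | true  = s≤s (count≤length p xs)
... | false = m≤n⇒m≤1+n (count≤length p xs)

numLeaves≤vertices : ∀ T → Tree.numLeaves T ≤ suc (Tree.m T)
numLeaves≤vertices T = subst (numLeaves ≤_) (length-tabulate {n = suc m} (λ u → u))
  (count≤length (λ u → degree u ≤ᵇ 1) (allFin (suc m)))
  where open Tree T

heapParent : ∀ {m} → Fin m → Fin (suc m)
heapParent i = fromℕ< (s≤s (≤-trans (⌊n/2⌋≤n (toℕ i)) (<⇒≤ (toℕ<n i))))

toℕ-heapParent : ∀ {m} (i : Fin m) → toℕ (heapParent i) ≡ ⌊ toℕ i /2⌋
toℕ-heapParent i = toℕ-fromℕ< _

heap : ℕ → Tree
heap m = record
  { m      = m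
  ; par    = heapParent
  ; par-lt = λ i → ≤-trans (≤-reflexive (toℕ-heapParent i)) (⌊n/2⌋≤n (toℕ i))
  }

heap-adjacent : ∀ {m} (i : Fin m) (v : Fin (suc m)) → ⌊ toℕ i /2⌋ ≡ toℕ v → Tree.Adj (heap m) (suc i) v
heap-adjacent i v eq = inj₁ (i , refl , toℕ-injective (trans (toℕ-heapParent i) eq))

module CompleteBinaryTree (d : ℕ) where

  M : ℕ
  M = pred (2 ^ suc d)

  T : Tree
  T = heap M

  open Tree T

  vertex : List Bool → Vertex
  vertex x = heapIndex x mod suc M

  heapIndex<vertices : length x ≤ d → heapIndex x < suc M
  heapIndex<vertices {x = x} le =
    s≤s (<⇒≤pred (≤-trans (m+n≤o⇒n≤o 1 (heapIndex-bound x)) (^-monoʳ-≤ 2 (s≤s le))))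

  toℕ-vertex : length x ≤ d → toℕ (vertex x) ≡ heapIndex x
  toℕ-vertex le = trans (toℕ-fromℕ< _) (m<n⇒m%n≡m (heapIndex<vertices le))

  vertex-injective : length x ≤ d → length y ≤ d → vertex x ≡ vertex y → x ≡ y
  vertex-injective lx ly eq = heapIndex-injective (trans (sym (toℕ-vertex lx)) (trans (cong toℕ eq) (toℕ-vertex ly)))

  vertex-adjacent : ∀ b x → suc (length x) ≤ d → Adj (vertex (b ∷ x)) (vertex x)
  vertex-adjacent b x le with vertex (b ∷ x) | toℕ-vertex {x = b ∷ x} le
  ... | suc i | eq = heap-adjacent i (vertex x)
    (trans (cong ⌊_/2⌋ (suc-injective eq)) (trans (⌊push/2⌋ b _) (sym (toℕ-vertex (<⇒≤ le)))))

  path-walk : ∀ x → length x ≤ d → Linked Adj (map vertex (tails x))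
  path-walk []      _  = [-]
  path-walk (b ∷ x) le = vertex-adjacent b x le ∷ path-walk x (<⇒≤ le)

  path-simple : ∀ x → length x ≤ d → Unique (map vertex (tails x))
  path-simple []      _  = All.[] ∷ []
  path-simple (b ∷ x) le = All.tabulate head-new ∷ path-simple x (<⇒≤ le)
    where
    head-new : ∀ {v} → v ∈ map vertex (tails x) → vertex (b ∷ x) ≢ v
    head-new v∈ eq with ∈-map⁻ vertex v∈
    ... | y , y∈ , refl = 1+n≰n (subst (λ z → length z ≤ length x) y≡bx (∈-tails-length x y∈))
      where
      y≡bx : y ≡ b ∷ x
      y≡bx = vertex-injective (≤-trans (∈-tails-length x y∈) (<⇒≤ le)) le (sym eq)

  path : ∀ x → length x ≤ d → Path
  path x le = record
    { verts    = map vertex (tails x)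
    ; nonempty = λ ()
    ; walk     = path-walk x le
    ; simple   = path-simple x le
    }

  ∈-path⁻ : ∀ {x y} → length x ≤ d → length y ≤ d → vertex y ∈ map vertex (tails x) → y ∈ tails x
  ∈-path⁻ {x} lx ly v∈ with ∈-map⁻ vertex v∈
  ... | z , z∈ , eq = subst (_∈ tails x) (sym (vertex-injective ly (≤-trans (∈-tails-length x z∈) lx) eq)) z∈

  rootPaths : Fin (2 ^ d) → Path
  rootPaths j = path (word d j) (≤-reflexive (word-length d j))

  rootPaths-distinct : DistinctPaths rootPaths
  rootPaths-distinct i j i≢j same = i≢j (word-injective d (∈-tails-≡ (word d j) wi∈ (here refl) equal-length))
    where
    wi∈ : word d i ∈ tails (word d j)
    wi∈ = ∈-path⁻ (≤-reflexive (word-length d j)) (≤-reflexive (word-length d i)) (proj₁ (same (vertex (word d i))) (here refl))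
    equal-length = trans (word-length d i) (sym (word-length d j))

  module _ {r} (c : Fin (2 ^ d) → Fin r) (cf : ConflictFree rootPaths c) where
    open SuffixColouring (word d) c

    uniqueColourAt : ∀ x → length x ≤ d → UniqueColourAt x
    uniqueColourAt x le with cf (vertex x) (let j , x∈ = ∈-tails-word d x le in j , ∈-map⁺ vertex x∈)
    ... | i , v∈ , uniq = i , ∈-path⁻ (≤-reflexive (word-length d i)) le v∈ , λ j x∈ → uniq j (∈-map⁺ vertex x∈)

    conflictFree⇒colours≥ : suc d ≤ r
    conflictFree⇒colours≥ = colours≥ (word-length d) uniqueColourAt

2^m≤2*2^[m∸1] : ∀ m → 2 ^ m ≤ 2 * 2 ^ (m ∸ 1)
2^m≤2*2^[m∸1] zero    = s≤s z≤n
2^m≤2*2^[m∸1] (suc m) = ≤-refl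

2*⌊n/2⌋≤n : ∀ n → 2 * ⌊ n /2⌋ ≤ n
2*⌊n/2⌋≤n n = begin
  2 * ⌊ n /2⌋         ≡⟨ cong (⌊ n /2⌋ +_) (+-identityʳ _) ⟩
  ⌊ n /2⌋ + ⌊ n /2⌋   ≤⟨ +-monoʳ-≤ ⌊ n /2⌋ (⌊n/2⌋≤⌈n/2⌉ n) ⟩
  ⌊ n /2⌋ + ⌈ n /2⌉   ≡⟨ ⌊n/2⌋+⌈n/2⌉≡n n ⟩
  n                   ∎
  where open ≤-Reasoning

2^⌊log₂n⌋≤n : ∀ n .{{_ : NonZero n}} → 2 ^ ⌊log₂ n ⌋ ≤ n
2^⌊log₂n⌋≤n n = go n (<-wellFounded n)
  where
  open ≤-Reasoning
  go : ∀ n .{{_ : NonZero n}} → Acc _<_ n → 2 ^ ⌊log₂ n ⌋ ≤ n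
  go 1                 _         = ≤-reflexive (cong (2 ^_) (⌊log₂[2^n]⌋≡n 0))
  go n@(suc (suc _)) (acc rec) = begin
    2 ^ ⌊log₂ n ⌋             ≤⟨ 2^m≤2*2^[m∸1] ⌊log₂ n ⌋ ⟩
    2 * 2 ^ (⌊log₂ n ⌋ ∸ 1)   ≡⟨ cong (λ e → 2 * 2 ^ e) (⌊log₂⌊n/2⌋⌋≡⌊log₂n⌋∸1 n) ⟨
    2 * 2 ^ ⌊log₂ ⌊ n /2⌋ ⌋   ≤⟨ *-monoʳ-≤ 2 (go ⌊ n /2⌋ (rec (⌊n/2⌋<n _))) ⟩
    2 * ⌊ n /2⌋               ≤⟨ 2*⌊n/2⌋≤n n ⟩
    n                         ∎

theorem3 : ∀ (n k : ℕ) → .{{_ : NonZero n}} → .{{_ : NonZero k}} →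
    Σ Tree λ T → Tree.numLeaves T ≤ k ×
      (Σ ℕ λ N → N ≤ n × Σ (Fin N → Tree.Path T) λ A → Tree.DistinctPaths T A ×
        (∀ (r : ℕ) (c : Fin N → Fin r) → Tree.ConflictFree T A c → ⌊log₂ (k ⊓ n) ⌋ ≤ r))
theorem3 n k with ⌊log₂ (k ⊓ n) ⌋ in log≡
... | zero  = heap 0 , ≤-trans (numLeaves≤vertices (heap 0)) (>-nonZero⁻¹ k) ,
              0 , z≤n , (λ ()) , (λ ()) , λ _ _ _ → z≤n
... | suc d = T , ≤-trans (numLeaves≤vertices T) (≤-trans vertices≤ (≤-trans 2^[1+d]≤k⊓n (m⊓n≤m k n))) ,
              2 ^ d , ≤-trans (^-monoʳ-≤ 2 (n≤1+n d)) (≤-trans 2^[1+d]≤k⊓n (m⊓n≤n k n)) ,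
              rootPaths , rootPaths-distinct , λ _ → conflictFree⇒colours≥
  where
  open CompleteBinaryTree d
  2^[1+d]≤k⊓n : 2 ^ suc d ≤ k ⊓ n
  2^[1+d]≤k⊓n = subst (λ e → 2 ^ e ≤ k ⊓ n) log≡
    (2^⌊log₂n⌋≤n (k ⊓ n) {{>-nonZero (⊓-glb (>-nonZero⁻¹ k) (>-nonZero⁻¹ n))}})
  vertices≤ : suc M ≤ 2 ^ suc d
  vertices≤ = ≤-reflexive (suc-pred (2 ^ suc d) {{m^n≢0 2 (suc d)}})
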